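{- Let $L$ be a literal that is pure in a schema $S$. If $S$ has a model $I$, then $S\{\top/L\}$ has a model $J$ such that $\rho_I(n)=\rho_J(n)$ for every parameter $n$ of $S$. Conversely, if $S\{\top/L\}$ has a model $I$, then $S$ has a model $J$ such that $\rho_I(n)=\rho_J(n)$ for every parameter $n$ of $S$.
   Context: Schemata are pairs $P\wedge\varphi_S$ of a pattern in negation normal form (built from $\top,\bot$, literals $p_{e_1,\dots,e_k}$, $\neg p_{e_1,\dots,e_k}$ with linear integer expressions as indices, $\wedge$, $\vee$ and iterations $\bigwedge_{i\mid\varphi}P$, $\bigvee_{i\mid\varphi}P$ with $\varphi$ a linear arithmetic constraint enclosing $i$) and a linear arithmetic constraint $\varphi_S$. Parameters are the free variables of the pattern. An environment $\rho$ of $S$ is a ground substitution of its parameters with $\varphi_S\rho$ true; $[S]_\rho$ is the propositional realization (iterations expanded into propositional conjunctions/disjunctions over all integers satisfying the domain, $\top$/$\bot$ if none). An interpretation $I$ consists of an environment $\rho_I$ and a propositional interpretation; it is a model of $S$ iff $[S]_{\rho_I}$ is true in it. A propositional literal is pure in a propositional formula iff its complement does not occur positively (not under negation) in it. A literal $L$ is pure in $S$ iff for every environment $\rho$ of $S$, $L\rho$ is propositionally pure in $[S]_\rho$. $S\{\top/L\}$ is the schema obtained by syntactically replacing every occurrence of the literal $L$ in the pattern of $S$ by $\top$ (only occurrences syntactically identical to $L$; the constraint is unchanged). -}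

module Defs where

open import Data.Nat as ℕ using (ℕ)
open import Data.Integer as ℤ using (ℤ)
open import Data.Bool using (Bool; true; false; if_then_else_)
open import Data.List using (List; []; _∷_; map)
open import Data.List.Properties using (≡-dec)
open import Data.List.Relation.Unary.Any using (Any)
open import Data.Product using (_×_; _,_; Σ)
open import Data.Sum using (_⊎_)
open import Data.Unit using (⊤)
open import Data.Empty using (⊥)
open import Relation.Nullary using (¬_; Dec; yes; no)
open import Relation.Nullary.Decidable using (⌊_⌋)
open import Relation.Binary.PropositionalEquality using (_≡_; _≢_; refl; cong; cong₂)

Var : Set
Var = ℕ

data Expr : Set where
  num   : ℤ → Expr
  var   : Var → Expr
  _⊕_   : Expr → Expr → Expr
  _⊛_   : ℤ → Expr → Expr

data Constr : Set where
  ctrue cfalse : Constr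
  _≤ᶜ_ _≐ᶜ_    : Expr → Expr → Constr
  _∧ᶜ_ _∨ᶜ_    : Constr → Constr → Constr
  ¬ᶜ_          : Constr → Constr
  ∃ᶜ           : Var → Constr → Constr

-- Literals p_{e1..ek} and ¬p_{e1..ek}; predicate symbols are naturals.
data Lit : Set where
  pos neg : ℕ → List Expr → Lit

-- Patterns in negation normal form.
data Pattern : Set where
  ⊤ᵖ ⊥ᵖ     : Pattern
  lit       : Lit → Pattern
  _∧ᵖ_ _∨ᵖ_ : Pattern → Pattern → Pattern
  ⋀ ⋁       : Var → Constr → Pattern → Pattern   -- ⋀_{i | φ} P , ⋁_{i | φ} P

record Schema : Set where
  constructor schema
  field
    pat    : Pattern
    constraint : Constr
open Schema public

_≟E_ : (e f : Expr) → Dec (e ≡ f)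
num a ≟E num b with a ℤ.≟ b
... | yes refl = yes refl
... | no ne = no λ { refl → ne refl }
num _ ≟E var _ = no λ ()
num _ ≟E (_ ⊕ _) = no λ ()
num _ ≟E (_ ⊛ _) = no λ ()
var _ ≟E num _ = no λ ()
var x ≟E var y with x ℕ.≟ y
... | yes refl = yes refl
... | no ne = no λ { refl → ne refl }
var _ ≟E (_ ⊕ _) = no λ ()
var _ ≟E (_ ⊛ _) = no λ ()
(_ ⊕ _) ≟E num _ = no λ ()
(_ ⊕ _) ≟E var _ = no λ ()
(e₁ ⊕ e₂) ≟E (f₁ ⊕ f₂) with e₁ ≟E f₁ | e₂ ≟E f₂
... | yes refl | yes refl = yes refl
... | no ne | _ = no λ { refl → ne refl }
... | yes _ | no ne = no λ { refl → ne refl }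
(_ ⊕ _) ≟E (_ ⊛ _) = no λ ()
(_ ⊛ _) ≟E num _ = no λ ()
(_ ⊛ _) ≟E var _ = no λ ()
(_ ⊛ _) ≟E (_ ⊕ _) = no λ ()
(a ⊛ e) ≟E (b ⊛ f) with a ℤ.≟ b | e ≟E f
... | yes refl | yes refl = yes refl
... | no ne | _ = no λ { refl → ne refl }
... | yes _ | no ne = no λ { refl → ne refl }

_≟L_ : (l m : Lit) → Dec (l ≡ m)
pos p es ≟L pos q fs with p ℕ.≟ q | ≡-dec _≟E_ es fs
... | yes refl | yes refl = yes refl
... | no ne | _ = no λ { refl → ne refl }
... | yes _ | no ne = no λ { refl → ne refl }
pos _ _ ≟L neg _ _ = no λ ()
neg _ _ ≟L pos _ _ = no λ ()
neg p es ≟L neg q fs with p ℕ.≟ q | ≡-dec _≟E_ es fs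
... | yes refl | yes refl = yes refl
... | no ne | _ = no λ { refl → ne refl }
... | yes _ | no ne = no λ { refl → ne refl }

_[⊤/_]ᵖ : Pattern → Lit → Pattern
⊤ᵖ [⊤/ L ]ᵖ = ⊤ᵖ
⊥ᵖ [⊤/ L ]ᵖ = ⊥ᵖ
lit l [⊤/ L ]ᵖ = if ⌊ l ≟L L ⌋ then ⊤ᵖ else lit l
(P ∧ᵖ Q) [⊤/ L ]ᵖ = (P [⊤/ L ]ᵖ) ∧ᵖ (Q [⊤/ L ]ᵖ)
(P ∨ᵖ Q) [⊤/ L ]ᵖ = (P [⊤/ L ]ᵖ) ∨ᵖ (Q [⊤/ L ]ᵖ)
⋀ i φ P [⊤/ L ]ᵖ = ⋀ i φ (P [⊤/ L ]ᵖ)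
⋁ i φ P [⊤/ L ]ᵖ = ⋁ i φ (P [⊤/ L ]ᵖ)

_[⊤/_] : Schema → Lit → Schema
S [⊤/ L ] = schema (pat S [⊤/ L ]ᵖ) (constraint S)

data VarE (x : Var) : Expr → Set where
  var  : VarE x (var x)
  ⊕ˡ   : ∀ {e f} → VarE x e → VarE x (e ⊕ f)
  ⊕ʳ   : ∀ {e f} → VarE x f → VarE x (e ⊕ f)
  ⊛    : ∀ {a e} → VarE x e → VarE x (a ⊛ e)

VarL : Var → Lit → Set
VarL x (pos _ es) = Any (VarE x) es
VarL x (neg _ es) = Any (VarE x) es

data FreeC (x : Var) : Constr → Set where
  ≤ˡ : ∀ {e f} → VarE x e → FreeC x (e ≤ᶜ f)
  ≤ʳ : ∀ {e f} → VarE x f → FreeC x (e ≤ᶜ f)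
  ≐ˡ : ∀ {e f} → VarE x e → FreeC x (e ≐ᶜ f)
  ≐ʳ : ∀ {e f} → VarE x f → FreeC x (e ≐ᶜ f)
  ∧ˡ : ∀ {φ ψ} → FreeC x φ → FreeC x (φ ∧ᶜ ψ)
  ∧ʳ : ∀ {φ ψ} → FreeC x ψ → FreeC x (φ ∧ᶜ ψ)
  ∨ˡ : ∀ {φ ψ} → FreeC x φ → FreeC x (φ ∨ᶜ ψ)
  ∨ʳ : ∀ {φ ψ} → FreeC x ψ → FreeC x (φ ∨ᶜ ψ)
  ¬c : ∀ {φ} → FreeC x φ → FreeC x (¬ᶜ φ)
  ∃c : ∀ {y φ} → x ≢ y → FreeC x φ → FreeC x (∃ᶜ y φ)

data FreeP (x : Var) : Pattern → Set where
  lit  : ∀ {l} → VarL x l → FreeP x (lit l)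
  ∧ˡ   : ∀ {P Q} → FreeP x P → FreeP x (P ∧ᵖ Q)
  ∧ʳ   : ∀ {P Q} → FreeP x Q → FreeP x (P ∧ᵖ Q)
  ∨ˡ   : ∀ {P Q} → FreeP x P → FreeP x (P ∨ᵖ Q)
  ∨ʳ   : ∀ {P Q} → FreeP x Q → FreeP x (P ∨ᵖ Q)
  ⋀φ   : ∀ {i φ P} → x ≢ i → FreeC x φ → FreeP x (⋀ i φ P)
  ⋀P   : ∀ {i φ P} → x ≢ i → FreeP x P → FreeP x (⋀ i φ P)
  ⋁φ   : ∀ {i φ P} → x ≢ i → FreeC x φ → FreeP x (⋁ i φ P)
  ⋁P   : ∀ {i φ P} → x ≢ i → FreeP x P → FreeP x (⋁ i φ P)

Parameter : Schema → Var → Set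
Parameter S x = FreeP x (pat S)

data BindsP (x : Var) : Pattern → Set where
  ∧ˡ   : ∀ {P Q} → BindsP x P → BindsP x (P ∧ᵖ Q)
  ∧ʳ   : ∀ {P Q} → BindsP x Q → BindsP x (P ∧ᵖ Q)
  ∨ˡ   : ∀ {P Q} → BindsP x P → BindsP x (P ∨ᵖ Q)
  ∨ʳ   : ∀ {P Q} → BindsP x Q → BindsP x (P ∨ᵖ Q)
  ⋀here : ∀ {φ P} → BindsP x (⋀ x φ P)
  ⋁here : ∀ {φ P} → BindsP x (⋁ x φ P)
  ⋀in  : ∀ {i φ P} → BindsP x P → BindsP x (⋀ i φ P)
  ⋁in  : ∀ {i φ P} → BindsP x P → BindsP x (⋁ i φ P)

-- Assignments of integers to variables (an environment is such an
-- assignment satisfying the schema's constraint).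
Env : Set
Env = Var → ℤ

_[_↦_] : Env → Var → ℤ → Env
(ρ [ i ↦ k ]) j = if ⌊ j ℕ.≟ i ⌋ then k else ρ j

evalE : Env → Expr → ℤ
evalE ρ (num a) = a
evalE ρ (var x) = ρ x
evalE ρ (e ⊕ f) = evalE ρ e ℤ.+ evalE ρ f
evalE ρ (a ⊛ e) = a ℤ.* evalE ρ e

⟦_⟧ᶜ : Constr → Env → Set
⟦ ctrue ⟧ᶜ ρ = ⊤
⟦ cfalse ⟧ᶜ ρ = ⊥
⟦ e ≤ᶜ f ⟧ᶜ ρ = evalE ρ e ℤ.≤ evalE ρ f
⟦ e ≐ᶜ f ⟧ᶜ ρ = evalE ρ e ≡ evalE ρ f
⟦ φ ∧ᶜ ψ ⟧ᶜ ρ = ⟦ φ ⟧ᶜ ρ × ⟦ ψ ⟧ᶜ ρ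
⟦ φ ∨ᶜ ψ ⟧ᶜ ρ = ⟦ φ ⟧ᶜ ρ ⊎ ⟦ ψ ⟧ᶜ ρ
⟦ ¬ᶜ φ ⟧ᶜ ρ = ¬ ⟦ φ ⟧ᶜ ρ
⟦ ∃ᶜ x φ ⟧ᶜ ρ = Σ ℤ λ k → ⟦ φ ⟧ᶜ (ρ [ x ↦ k ])

data GLit : Set where
  gpos gneg : ℕ → List ℤ → GLit

complement : GLit → GLit
complement (gpos p ks) = gneg p ks
complement (gneg p ks) = gpos p ks

groundL : Env → Lit → GLit
groundL ρ (pos p es) = gpos p (map (evalE ρ) es)
groundL ρ (neg p es) = gneg p (map (evalE ρ) es)

-- Propositional literal occurrences in the realization [P]_ρ
-- (iterations expanded over all integers satisfying their domain).
data Occ : Env → Pattern → GLit → Set where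
  lit  : ∀ {ρ l} → Occ ρ (lit l) (groundL ρ l)
  ∧ˡ   : ∀ {ρ P Q g} → Occ ρ P g → Occ ρ (P ∧ᵖ Q) g
  ∧ʳ   : ∀ {ρ P Q g} → Occ ρ Q g → Occ ρ (P ∧ᵖ Q) g
  ∨ˡ   : ∀ {ρ P Q g} → Occ ρ P g → Occ ρ (P ∨ᵖ Q) g
  ∨ʳ   : ∀ {ρ P Q g} → Occ ρ Q g → Occ ρ (P ∨ᵖ Q) g
  ⋀k   : ∀ {ρ i φ P g} (k : ℤ) → ⟦ φ ⟧ᶜ (ρ [ i ↦ k ]) →
         Occ (ρ [ i ↦ k ]) P g → Occ ρ (⋀ i φ P) g
  ⋁k   : ∀ {ρ i φ P g} (k : ℤ) → ⟦ φ ⟧ᶜ (ρ [ i ↦ k ]) →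
         Occ (ρ [ i ↦ k ]) P g → Occ ρ (⋁ i φ P) g

Pure : Lit → Schema → Set
Pure L S = ∀ (ρ : Env) → ⟦ constraint S ⟧ᶜ ρ →
           ¬ Occ ρ (pat S) (complement (groundL ρ L))

record Interp : Set where
  constructor interp
  field
    env : Env
    val : ℕ → List ℤ → Bool
open Interp public

⟦_⟧ᵖ : Pattern → Env → (ℕ → List ℤ → Bool) → Set
⟦ ⊤ᵖ ⟧ᵖ ρ v = ⊤
⟦ ⊥ᵖ ⟧ᵖ ρ v = ⊥
⟦ lit (pos p es) ⟧ᵖ ρ v = v p (map (evalE ρ) es) ≡ true
⟦ lit (neg p es) ⟧ᵖ ρ v = v p (map (evalE ρ) es) ≡ false
⟦ P ∧ᵖ Q ⟧ᵖ ρ v = ⟦ P ⟧ᵖ ρ v × ⟦ Q ⟧ᵖ ρ v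
⟦ P ∨ᵖ Q ⟧ᵖ ρ v = ⟦ P ⟧ᵖ ρ v ⊎ ⟦ Q ⟧ᵖ ρ v
⟦ ⋀ i φ P ⟧ᵖ ρ v = ∀ (k : ℤ) → ⟦ φ ⟧ᶜ (ρ [ i ↦ k ]) → ⟦ P ⟧ᵖ (ρ [ i ↦ k ]) v
⟦ ⋁ i φ P ⟧ᵖ ρ v = Σ ℤ λ k → ⟦ φ ⟧ᶜ (ρ [ i ↦ k ]) × ⟦ P ⟧ᵖ (ρ [ i ↦ k ]) v

_⊨_ : Interp → Schema → Set
I ⊨ S = ⟦ constraint S ⟧ᶜ (env I) × ⟦ pat S ⟧ᵖ (env I) (val I)

module Submission where

-- Replacing L by ⊤ in a pattern in negation normal form can only make it
-- truer, so a model of S is already a model of S{⊤/L}.  Conversely, since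
-- no variable of L is bound by an iteration of S, every occurrence of L in
-- the realization [S]_ρ grounds to the same propositional literal Lρ.
-- Making Lρ true turns a model of S{⊤/L} into a model of S: the replaced
-- occurrences become true, and by purity no other literal of [S]_ρ is the
-- complement of Lρ, so none of them changes its truth value.

open import Defs
open import Data.Nat as ℕ using (ℕ)
open import Data.Integer as ℤ using (ℤ)
open import Data.Bool using (Bool; true; false)
open import Data.List using (List; []; _∷_; map)
open import Data.List.Properties using (≡-dec)
open import Data.List.Relation.Unary.Any using (Any; here; there)
open import Data.Product using (_×_; Σ; _,_)
open import Data.Sum using (inj₁; inj₂)
open import Data.Empty using (⊥-elim)
open import Function using (_∘_)
open import Relation.Nullary using (¬_; yes; no)
open import Relation.Binary.PropositionalEquality
  using (_≡_; _≢_; refl; cong; cong₂; subst; trans)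

Valuation : Set
Valuation = ℕ → List ℤ → Bool

_[_,_≔_] : Valuation → ℕ → List ℤ → Bool → Valuation
(v [ q , gs ≔ b ]) p ks with p ℕ.≟ q | ≡-dec ℤ._≟_ ks gs
... | yes _ | yes _ = b
... | _     | _     = v p ks

update-≡ : ∀ v q gs b → (v [ q , gs ≔ b ]) q gs ≡ b
update-≡ v q gs b with q ℕ.≟ q | ≡-dec ℤ._≟_ gs gs
... | yes _   | yes _    = refl
... | no q≢q  | _        = ⊥-elim (q≢q refl)
... | yes _   | no gs≢gs = ⊥-elim (gs≢gs refl)

update-preserves : ∀ v p ks q gs {b c} → (p ≡ q → ks ≡ gs → b ≡ c) →
                   v p ks ≡ c → (v [ q , gs ≔ b ]) p ks ≡ c
update-preserves v p ks q gs b≡c vpks≡c with p ℕ.≟ q | ≡-dec ℤ._≟_ ks gs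
... | yes p≡q | yes ks≡gs = b≡c p≡q ks≡gs
... | no _    | _         = vpks≡c
... | yes _   | no _      = vpks≡c

satisfy : GLit → Valuation → Valuation
satisfy (gpos q gs) v = v [ q , gs ≔ true ]
satisfy (gneg q gs) v = v [ q , gs ≔ false ]

satisfy-holds : ∀ l {ρ g} v → groundL ρ l ≡ g → ⟦ lit l ⟧ᵖ ρ (satisfy g v)
satisfy-holds (pos p es) v refl = update-≡ v p _ true
satisfy-holds (neg p es) v refl = update-≡ v p _ false

satisfy-preserves : ∀ l {ρ} g v → groundL ρ l ≢ complement g →
                    ⟦ lit l ⟧ᵖ ρ v → ⟦ lit l ⟧ᵖ ρ (satisfy g v)
satisfy-preserves (pos p es) (gpos q gs) v _ = update-preserves v p _ q gs λ _ _ → refl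
satisfy-preserves (neg p es) (gneg q gs) v _ = update-preserves v p _ q gs λ _ _ → refl
satisfy-preserves (pos p es) (gneg q gs) v l≢gᶜ =
  update-preserves v p _ q gs λ { refl es≡gs → ⊥-elim (l≢gᶜ (cong (gpos p) es≡gs)) }
satisfy-preserves (neg p es) (gpos q gs) v l≢gᶜ =
  update-preserves v p _ q gs λ { refl es≡gs → ⊥-elim (l≢gᶜ (cong (gneg p) es≡gs)) }

evalE-local : ∀ {ρ σ} e → (∀ x → VarE x e → ρ x ≡ σ x) → evalE ρ e ≡ evalE σ e
evalE-local (num a) agree = refl
evalE-local (var x) agree = agree x var
evalE-local (e ⊕ f) agree =
  cong₂ ℤ._+_ (evalE-local e (λ x → agree x ∘ ⊕ˡ)) (evalE-local f (λ x → agree x ∘ ⊕ʳ))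
evalE-local (a ⊛ e) agree = cong (a ℤ.*_) (evalE-local e (λ x → agree x ∘ ⊛))

map-evalE-local : ∀ {ρ σ} es → (∀ x → Any (VarE x) es → ρ x ≡ σ x) →
                  map (evalE ρ) es ≡ map (evalE σ) es
map-evalE-local []       agree = refl
map-evalE-local (e ∷ es) agree =
  cong₂ _∷_ (evalE-local e (λ x → agree x ∘ here)) (map-evalE-local es (λ x → agree x ∘ there))

groundL-local : ∀ {ρ σ} l → (∀ x → VarL x l → ρ x ≡ σ x) → groundL ρ l ≡ groundL σ l
groundL-local (pos p es) agree = cong (gpos p) (map-evalE-local es agree)
groundL-local (neg p es) agree = cong (gneg p) (map-evalE-local es agree)

update-≢ : ∀ (ρ : Env) {i j} k → j ≢ i → (ρ [ i ↦ k ]) j ≡ ρ j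
update-≢ ρ {i} {j} k j≢i with j ℕ.≟ i
... | yes j≡i = ⊥-elim (j≢i j≡i)
... | no _    = refl

groundL-update : ∀ {ρ i} k l → (∀ x → VarL x l → x ≢ i) →
                 groundL (ρ [ i ↦ k ]) l ≡ groundL ρ l
groundL-update {ρ} k l l∌i = groundL-local l λ x x∈l → update-≢ ρ k (l∌i x x∈l)

[⊤/]ᵖ-weakens : ∀ L P {ρ v} → ⟦ P ⟧ᵖ ρ v → ⟦ P [⊤/ L ]ᵖ ⟧ᵖ ρ v
[⊤/]ᵖ-weakens L ⊤ᵖ      h = h
[⊤/]ᵖ-weakens L ⊥ᵖ      h = h
[⊤/]ᵖ-weakens L (lit l) h with l ≟L L
... | yes _ = _
... | no _  = h
[⊤/]ᵖ-weakens L (P ∧ᵖ Q) (hP , hQ) = [⊤/]ᵖ-weakens L P hP , [⊤/]ᵖ-weakens L Q hQ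
[⊤/]ᵖ-weakens L (P ∨ᵖ Q) (inj₁ hP) = inj₁ ([⊤/]ᵖ-weakens L P hP)
[⊤/]ᵖ-weakens L (P ∨ᵖ Q) (inj₂ hQ) = inj₂ ([⊤/]ᵖ-weakens L Q hQ)
[⊤/]ᵖ-weakens L (⋀ i φ P) h            = λ k φk → [⊤/]ᵖ-weakens L P (h k φk)
[⊤/]ᵖ-weakens L (⋁ i φ P) (k , φk , h) = k , φk , [⊤/]ᵖ-weakens L P h

Unbound : Lit → Pattern → Set
Unbound L P = ∀ x → VarL x L → ¬ BindsP x P

unbound-sub : ∀ {L P Q} → (∀ {x} → BindsP x P → BindsP x Q) → Unbound L Q → Unbound L P
unbound-sub P⊆Q unbound x x∈L = unbound x x∈L ∘ P⊆Q

[⊤/]ᵖ-satisfy : ∀ {L g} P {ρ v} → Unbound L P → groundL ρ L ≡ g →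
                ¬ Occ ρ P (complement g) →
                ⟦ P [⊤/ L ]ᵖ ⟧ᵖ ρ v → ⟦ P ⟧ᵖ ρ (satisfy g v)
[⊤/]ᵖ-satisfy ⊤ᵖ _ _ _ h = h
[⊤/]ᵖ-satisfy ⊥ᵖ _ _ _ h = h
[⊤/]ᵖ-satisfy {L} {g} (lit l) {ρ} {v} _ Lρ≡g no-gᶜ h with l ≟L L
... | yes refl = satisfy-holds l v Lρ≡g
... | no _     = satisfy-preserves l g v (λ l≡gᶜ → no-gᶜ (subst (Occ ρ (lit l)) l≡gᶜ lit)) h
[⊤/]ᵖ-satisfy (P ∧ᵖ Q) unbound Lρ≡g no-gᶜ (hP , hQ) =
  [⊤/]ᵖ-satisfy P (unbound-sub ∧ˡ unbound) Lρ≡g (no-gᶜ ∘ ∧ˡ) hP ,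
  [⊤/]ᵖ-satisfy Q (unbound-sub ∧ʳ unbound) Lρ≡g (no-gᶜ ∘ ∧ʳ) hQ
[⊤/]ᵖ-satisfy (P ∨ᵖ Q) unbound Lρ≡g no-gᶜ (inj₁ hP) =
  inj₁ ([⊤/]ᵖ-satisfy P (unbound-sub ∨ˡ unbound) Lρ≡g (no-gᶜ ∘ ∨ˡ) hP)
[⊤/]ᵖ-satisfy (P ∨ᵖ Q) unbound Lρ≡g no-gᶜ (inj₂ hQ) =
  inj₂ ([⊤/]ᵖ-satisfy Q (unbound-sub ∨ʳ unbound) Lρ≡g (no-gᶜ ∘ ∨ʳ) hQ)
[⊤/]ᵖ-satisfy {L} (⋀ i φ P) unbound Lρ≡g no-gᶜ h = λ k φk →
  [⊤/]ᵖ-satisfy P (unbound-sub ⋀in unbound)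
    (trans (groundL-update k L λ { x x∈L refl → unbound x x∈L ⋀here }) Lρ≡g)
    (no-gᶜ ∘ ⋀k k φk) (h k φk)
[⊤/]ᵖ-satisfy {L} (⋁ i φ P) unbound Lρ≡g no-gᶜ (k , φk , h) = k , φk ,
  [⊤/]ᵖ-satisfy P (unbound-sub ⋁in unbound)
    (trans (groundL-update k L λ { x x∈L refl → unbound x x∈L ⋁here }) Lρ≡g)
    (no-gᶜ ∘ ⋁k k φk) h

proposition6 : (S : Schema) (L : Lit) →
    (∀ x → VarL x L → ¬ BindsP x (pat S)) →
    Pure L S →
    ((I : Interp) → I ⊨ S →
       Σ Interp λ J → (J ⊨ (S [⊤/ L ])) × (∀ n → Parameter S n → env I n ≡ env J n))
    × ((I : Interp) → I ⊨ (S [⊤/ L ]) →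
       Σ Interp λ J → (J ⊨ S) × (∀ n → Parameter S n → env I n ≡ env J n))
proposition6 S L unbound pure = model-of-[⊤/] , model-of-S
  where
  model-of-[⊤/] : (I : Interp) → I ⊨ S →
    Σ Interp λ J → (J ⊨ (S [⊤/ L ])) × (∀ n → Parameter S n → env I n ≡ env J n)
  model-of-[⊤/] I (φρ , Sρ) = I , (φρ , [⊤/]ᵖ-weakens L (pat S) Sρ) , λ _ _ → refl

  model-of-S : (I : Interp) → I ⊨ (S [⊤/ L ]) →
    Σ Interp λ J → (J ⊨ S) × (∀ n → Parameter S n → env I n ≡ env J n)
  model-of-S (interp ρ v) (φρ , S[⊤/L]ρ) =
    interp ρ (satisfy (groundL ρ L) v) ,
    (φρ , [⊤/]ᵖ-satisfy (pat S) unbound refl (pure ρ φρ) S[⊤/L]ρ) ,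
    λ _ _ → refl
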